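{- Let $s_1,s_2$ be probability distributions on $\{1,\dots,V\}$ with cumulative sums $S_1,S_2$ and with $S_1(j),S_2(j)<1$ for $j<V$, and let $1\le C<V$. If $S_1(j)\ge S_2(j)$ for all $j$, then $L^{\mathrm{OPT}}[s_1]\le L^{\mathrm{OPT}}[s_2]$.
   Context: For a distribution $s$ on $\{1,\dots,V\}$ with cumulative $S(j)=\sum_{i\le j}s(i)$, $S(0)=0$, and buffer capacity $C$: $L^{\mathrm{OPT}}[s]=\max_{G\in\{1,\dots,V-C\}}G\left(\sum_{j=0}^{C+G-1}\frac{1}{1-S(j)}\right)^{ -1}$.
   Formalization: The probability distributions $s_1,s_2$ are rational-valued, so their cumulative sums $S_1,S_2$ are rational as well. -}

module Defs where

open import Data.Nat as ℕ using (ℕ; zero; suc; _∸_)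
open import Data.Rational using (ℚ; 0ℚ; 1ℚ; _+_; _-_; _*_; _⊔_; 1/_; ≢-nonZero; _≤_; _<_)
open import Data.Rational.Properties using (_≟_)
open import Data.Product using (_×_)
open import Relation.Nullary using (yes; no)
open import Relation.Binary.PropositionalEquality using (_≡_)

nat : ℕ → ℚ
nat n = Data.Integer.+ n Data.Rational./ 1
  where import Data.Integer; import Data.Rational

-- reciprocal, with the (irrelevant) convention 1/0 := 0;
-- it is only ever applied to strictly positive arguments below.
recip : ℚ → ℚ
recip q with q ≟ 0ℚ
... | yes _ = 0ℚ
... | no q≢0 = 1/_ q {{≢-nonZero q≢0}}

cum : (ℕ → ℚ) → ℕ → ℚ
cum s zero    = 0ℚ
cum s (suc j) = cum s j + s (suc j)

sumBelow : (ℕ → ℚ) → ℕ → ℚ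
sumBelow f zero    = 0ℚ
sumBelow f (suc n) = sumBelow f n + f n

IsDist : ℕ → (ℕ → ℚ) → Set
IsDist V s = (∀ i → 1 ℕ.≤ i → i ℕ.≤ V → 0ℚ ≤ s i) × (cum s V ≡ 1ℚ)

objective : ℕ → (ℕ → ℚ) → ℕ → ℚ
objective C s G = nat G * recip (sumBelow (λ j → recip (1ℚ - cum s j)) (C ℕ.+ G))

-- max_{G ∈ {1,…,n}} f(G)   (n ≥ 1 in all uses; value 0 for n = 0)
maxUpTo : (ℕ → ℚ) → ℕ → ℚ
maxUpTo f zero          = 0ℚ
maxUpTo f (suc zero)    = f 1
maxUpTo f (suc (suc n)) = f (suc (suc n)) ⊔ maxUpTo f (suc n)

Lopt : ℕ → ℕ → (ℕ → ℚ) → ℚ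
Lopt V C s = maxUpTo (objective C s) (V ∸ C)

{-# OPTIONS --safe #-}
module Submission where

-- Pointwise S₂ ≤ S₁ < 1 gives 1/(1 − S₁(j)) ≥ 1/(1 − S₂(j)) for every j < V, so for each
-- admissible G the sum inside the objective is larger for s₁; as that sum is positive and
-- is inverted, objective s₁ G ≤ objective s₂ G, and taking the maximum over G preserves this.

open import Defs
open import Data.Nat using (ℕ; _<_) renaming (_≤_ to _≤ₙ_)
open import Data.Rational using (ℚ; 1ℚ) renaming (_≤_ to _≤ℚ_; _<_ to _<ℚ_)
import Data.Nat as ℕ
import Data.Nat.Properties as ℕ
open import Data.Rational using (0ℚ; _-_; _*_; -_; 1/_; Positive; positive)
open import Data.Rational.Properties
open import Data.Empty using (⊥-elim)
open import Relation.Nullary using (yes; no)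
open import Relation.Binary.PropositionalEquality using (refl; sym; cong; subst)

1/-antimono-≤-pos : ∀ {p q} .{{_ : Positive p}} .{{_ : Positive q}} → p ≤ℚ q →
                    (1/ q) {{pos⇒nonZero q}} ≤ℚ (1/ p) {{pos⇒nonZero p}}
1/-antimono-≤-pos {p} {q} p≤q = begin
  1/q              ≡⟨ sym (*-identityʳ 1/q) ⟩
  1/q * 1ℚ         ≡⟨ cong (1/q *_) (sym (*-inverseʳ p {{pos⇒nonZero p}})) ⟩
  1/q * (p * 1/p)  ≡⟨ sym (*-assoc 1/q p 1/p) ⟩
  (1/q * p) * 1/p  ≤⟨ *-monoʳ-≤-nonNeg 1/p {{pos⇒nonNeg 1/p {{1/pos⇒pos p}}}}
                        (*-monoˡ-≤-nonNeg 1/q {{pos⇒nonNeg 1/q {{1/pos⇒pos q}}}} p≤q) ⟩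
  (1/q * q) * 1/p  ≡⟨ cong (_* 1/p) (*-inverseˡ q {{pos⇒nonZero q}}) ⟩
  1ℚ * 1/p         ≡⟨ *-identityˡ 1/p ⟩
  1/p              ∎
  where
  open ≤-Reasoning
  1/q = (1/ q) {{pos⇒nonZero q}}
  1/p = (1/ p) {{pos⇒nonZero p}}

recip-pos : ∀ {p} → 0ℚ <ℚ p → 0ℚ <ℚ recip p
recip-pos {p} 0<p with p ≟ 0ℚ
... | yes refl = ⊥-elim (<-irrefl refl 0<p)
... | no _     = positive⁻¹ _ {{1/pos⇒pos p {{positive 0<p}}}}

recip-antimono-≤ : ∀ {p q} → 0ℚ <ℚ p → p ≤ℚ q → recip q ≤ℚ recip p
recip-antimono-≤ {p} {q} 0<p p≤q with p ≟ 0ℚ | q ≟ 0ℚ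
... | yes refl | _        = ⊥-elim (<-irrefl refl 0<p)
... | no _     | yes refl = ⊥-elim (<-irrefl refl (<-≤-trans 0<p p≤q))
... | no _     | no _     =
  1/-antimono-≤-pos {{positive 0<p}} {{positive (<-≤-trans 0<p p≤q)}} p≤q

p<q⇒0<q-p : ∀ {p q} → p <ℚ q → 0ℚ <ℚ q - p
p<q⇒0<q-p {p} {q} p<q = subst (_<ℚ q - p) (+-inverseʳ p) (+-monoˡ-< (- p) p<q)

sumBelow-mono-≤ : ∀ {f g : ℕ → ℚ} n → (∀ j → j < n → f j ≤ℚ g j) →
                  sumBelow f n ≤ℚ sumBelow g n
sumBelow-mono-≤ ℕ.zero    f≤g = ≤-refl
sumBelow-mono-≤ (ℕ.suc n) f≤g =
  +-mono-≤ (sumBelow-mono-≤ n (λ j j<n → f≤g j (ℕ.m<n⇒m<1+n j<n))) (f≤g n ℕ.≤-refl)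

sumBelow-nonNeg : ∀ {f : ℕ → ℚ} n → (∀ j → j < n → 0ℚ ≤ℚ f j) → 0ℚ ≤ℚ sumBelow f n
sumBelow-nonNeg ℕ.zero    0≤f = ≤-refl
sumBelow-nonNeg (ℕ.suc n) 0≤f =
  +-mono-≤ (sumBelow-nonNeg n (λ j j<n → 0≤f j (ℕ.m<n⇒m<1+n j<n))) (0≤f n ℕ.≤-refl)

sumBelow-pos : ∀ {f : ℕ → ℚ} n → 1 ≤ₙ n → (∀ j → j < n → 0ℚ <ℚ f j) → 0ℚ <ℚ sumBelow f n
sumBelow-pos (ℕ.suc n) _ 0<f =
  +-mono-≤-< (sumBelow-nonNeg n (λ j j<n → <⇒≤ (0<f j (ℕ.m<n⇒m<1+n j<n)))) (0<f n ℕ.≤-refl)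

maxUpTo-mono-≤ : ∀ {f g : ℕ → ℚ} n → (∀ G → 1 ≤ₙ G → G ≤ₙ n → f G ≤ℚ g G) →
                 maxUpTo f n ≤ℚ maxUpTo g n
maxUpTo-mono-≤ ℕ.zero                f≤g = ≤-refl
maxUpTo-mono-≤ (ℕ.suc ℕ.zero)        f≤g = f≤g 1 ℕ.≤-refl ℕ.≤-refl
maxUpTo-mono-≤ (ℕ.suc n@(ℕ.suc _)) f≤g =
  ⊔-mono-≤ (f≤g (ℕ.suc n) (ℕ.s≤s ℕ.z≤n) ℕ.≤-refl)
           (maxUpTo-mono-≤ n (λ G 1≤G G≤n → f≤g G 1≤G (ℕ.m≤n⇒m≤1+n G≤n)))

objective-antimono : ∀ C G (s₁ s₂ : ℕ → ℚ) → 1 ≤ₙ C →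
                     (∀ j → j < C ℕ.+ G → cum s₁ j <ℚ 1ℚ) →
                     (∀ j → j < C ℕ.+ G → cum s₂ j ≤ℚ cum s₁ j) →
                     objective C s₁ G ≤ℚ objective C s₂ G
objective-antimono C G s₁ s₂ 1≤C S₁<1 S₂≤S₁ =
  *-monoˡ-≤-nonNeg (nat G) {{normalize-nonNeg G 1}}
    (recip-antimono-≤ sum₂-pos (sumBelow-mono-≤ (C ℕ.+ G) term-antimono))
  where
  0<1-S₁ : ∀ j → j < C ℕ.+ G → 0ℚ <ℚ 1ℚ - cum s₁ j
  0<1-S₁ j j<n = p<q⇒0<q-p (S₁<1 j j<n)

  1-S₁≤1-S₂ : ∀ j → j < C ℕ.+ G → 1ℚ - cum s₁ j ≤ℚ 1ℚ - cum s₂ j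
  1-S₁≤1-S₂ j j<n = +-monoʳ-≤ 1ℚ (neg-antimono-≤ (S₂≤S₁ j j<n))

  term-antimono : ∀ j → j < C ℕ.+ G → recip (1ℚ - cum s₂ j) ≤ℚ recip (1ℚ - cum s₁ j)
  term-antimono j j<n = recip-antimono-≤ (0<1-S₁ j j<n) (1-S₁≤1-S₂ j j<n)

  sum₂-pos : 0ℚ <ℚ sumBelow (λ j → recip (1ℚ - cum s₂ j)) (C ℕ.+ G)
  sum₂-pos = sumBelow-pos (C ℕ.+ G) (ℕ.≤-trans 1≤C (ℕ.m≤m+n C G))
    (λ j j<n → recip-pos (<-≤-trans (0<1-S₁ j j<n) (1-S₁≤1-S₂ j j<n)))

lemma3 : (V C : ℕ) (s₁ s₂ : ℕ → ℚ)
       → IsDist V s₁ → IsDist V s₂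
       → (∀ j → j < V → cum s₁ j <ℚ 1ℚ)
       → (∀ j → j < V → cum s₂ j <ℚ 1ℚ)
       → 1 ≤ₙ C → C < V
       → (∀ j → j ≤ₙ V → cum s₂ j ≤ℚ cum s₁ j)
       → Lopt V C s₁ ≤ℚ Lopt V C s₂
lemma3 V C s₁ s₂ _ _ S₁<1 _ 1≤C C<V S₂≤S₁ =
  maxUpTo-mono-≤ (V ℕ.∸ C) λ G _ G≤V-C →
    let window⊆V : ∀ j → j < C ℕ.+ G → j < V
        window⊆V j j<C+G = ℕ.<-≤-trans j<C+G
          (ℕ.≤-trans (ℕ.+-monoʳ-≤ C G≤V-C) (ℕ.≤-reflexive (ℕ.m+[n∸m]≡n (ℕ.<⇒≤ C<V))))
    in objective-antimono C G s₁ s₂ 1≤C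
         (λ j j<C+G → S₁<1 j (window⊆V j j<C+G))
         (λ j j<C+G → S₂≤S₁ j (ℕ.<⇒≤ (window⊆V j j<C+G)))
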